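{- $\mathrm{CSP}(\mathbb{Q};\mathrm{X})$ is expressible in $\mathrm{FPR}_2$, where $\mathrm{X}=\{(x,y,z)\in\mathbb{Q}^3: x=y<z \text{ or } y=z<x \text{ or } z=x<y\}$.
   Context: For a structure $\mathfrak{B}$ with finite relational signature $\tau$, $\mathrm{CSP}(\mathfrak{B})$ is the class of finite $\tau$-structures admitting a homomorphism to $\mathfrak{B}$; it is expressible in a logic if some sentence of the logic holds exactly in the finite $\tau$-structures that admit no homomorphism to $\mathfrak{B}$. $\mathrm{FPR}_2$ is fixed-point logic with counting extended by the rank operator for matrices over the two-element field. -}

module Defs where

open import Data.Nat using (ℕ; zero; suc; _+_; _*_; _⊔_; _≡ᵇ_; _≤ᵇ_)
open import Data.Fin using (Fin; toℕ)
import Data.Fin as F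
open import Data.Bool using (Bool; true; false; _∧_; _∨_; not; if_then_else_; _xor_)
open import Data.List using (List; []; _∷_; map; concatMap; foldr; length; allFin; _++_; and; replicate; zipWith)
open import Data.Bool.ListAction using (all; any)
open import Data.List.Relation.Unary.All as All using (All; []; _∷_)
open import Data.List.Membership.Propositional using (_∈_)
open import Data.Vec as Vec using (Vec)
open import Data.Rational using (ℚ; _<_)
open import Data.Product using (Σ; _×_)
open import Data.Sum using (_⊎_)
open import Relation.Binary.PropositionalEquality using (_≡_)
open import Relation.Nullary using (¬_; does)
open import Function.Bundles using (_⇔_)

record Signature : Set where
  field
    symbols : ℕ
    arity   : Fin symbols → ℕ

open Signature public

record Structure (τ : Signature) : Set where
  field
    dom : ℕ
    rel : (R : Fin (symbols τ)) → Vec (Fin dom) (arity τ R) → Bool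

open Structure public

-- Syntax of FPR₂ (fixed-point logic with counting and rank over GF(2)).
-- Two sorts: structure elements and numbers {0,…,n} (n = domain size).
-- Formulas are indexed by the types of the free second-order (fixed-point)
-- variables Δ and the sorts of the free first-order variables Γ.

data Sort : Set where
  elem num : Sort

data Formula (τ : Signature) : List (List Sort) → List Sort → Set where
  atom  : ∀ {Δ Γ} (R : Fin (symbols τ)) → Vec (elem ∈ Γ) (arity τ R) → Formula τ Δ Γ
  eq    : ∀ {Δ Γ s} → s ∈ Γ → s ∈ Γ → Formula τ Δ Γ
  leq   : ∀ {Δ Γ} → num ∈ Γ → num ∈ Γ → Formula τ Δ Γ
  rvar  : ∀ {Δ Γ ss} → ss ∈ Δ → All (_∈ Γ) ss → Formula τ Δ Γ
  neg   : ∀ {Δ Γ} → Formula τ Δ Γ → Formula τ Δ Γ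
  conj  : ∀ {Δ Γ} → Formula τ Δ Γ → Formula τ Δ Γ → Formula τ Δ Γ
  exi   : ∀ {Δ Γ} (s : Sort) → Formula τ Δ (s ∷ Γ) → Formula τ Δ Γ
  -- [ifp_{X, x̄} φ](t̄) : inflationary fixed point, X of type ss bound,
  -- x̄ of sorts ss bound, other free variables of φ are parameters
  ifp   : ∀ {Δ Γ} (ss : List Sort) → Formula τ (ss ∷ Δ) (ss ++ Γ) →
          All (_∈ Γ) ss → Formula τ Δ Γ
  -- #x̄.φ = ν̄ : the number of tuples x̄ (sorts ss) satisfying φ equals the
  -- number encoded (base n+1, least significant digit first) by ν̄
  count : ∀ {Δ Γ} (ss : List Sort) → Formula τ Δ (ss ++ Γ) →
          (m : ℕ) → Vec (num ∈ Γ) m → Formula τ Δ Γ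
  -- rk₂(x̄,ȳ).φ = ν̄ : the rank over GF(2) of the 0/1-matrix with rows
  -- indexed by x̄ (sorts xs), columns by ȳ (sorts ys) and entry 1 iff φ
  -- holds, equals the number encoded by ν̄
  rank  : ∀ {Δ Γ} (xs ys : List Sort) → Formula τ Δ (xs ++ ys ++ Γ) →
          (m : ℕ) → Vec (num ∈ Γ) m → Formula τ Δ Γ

Sentence : Signature → Set
Sentence τ = Formula τ [] []

subsequences : {A : Set} → List A → List (List A)
subsequences []       = [] ∷ []
subsequences (x ∷ xs) = let r = subsequences xs in map (x ∷_) r ++ r

vsum : ℕ → List (List Bool) → List Bool
vsum c = foldr (zipWith _xor_) (replicate c false)

isZeroVec : List Bool → Bool
isZeroVec = all not

nonEmpty : {A : Set} → List A → Bool
nonEmpty []      = false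
nonEmpty (_ ∷ _) = true

independent₂ : ℕ → List (List Bool) → Bool
independent₂ c vs = all (λ s → not (nonEmpty s) ∨ not (isZeroVec (vsum c s))) (subsequences vs)

rank₂ : ℕ → List (List Bool) → ℕ
rank₂ c rows = foldr (λ s acc → (if independent₂ c s then length s else 0) ⊔ acc) 0 (subsequences rows)

module Semantics {τ : Signature} (A : Structure τ) where

  n : ℕ
  n = dom A

  ⟦_⟧ : Sort → Set
  ⟦ elem ⟧ = Fin n
  ⟦ num  ⟧ = Fin (suc n)

  Tuple : List Sort → Set
  Tuple = All ⟦_⟧

  enum : (s : Sort) → List ⟦ s ⟧
  enum elem = allFin n
  enum num  = allFin (suc n)

  tuples : (ss : List Sort) → List (Tuple ss)
  tuples []       = [] ∷ []
  tuples (s ∷ ss) = concatMap (λ a → map (a ∷_) (tuples ss)) (enum s)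

  _⊕_ : ∀ {ss Γ} → Tuple ss → Tuple Γ → Tuple (ss ++ Γ)
  []       ⊕ ρ = ρ
  (a ∷ t) ⊕ ρ = a ∷ (t ⊕ ρ)

  eqS : (s : Sort) → ⟦ s ⟧ → ⟦ s ⟧ → Bool
  eqS elem a b = does (a F.≟ b)
  eqS num  a b = does (a F.≟ b)

  RelEnv : List (List Sort) → Set
  RelEnv = All (λ ss → Tuple ss → Bool)

  numVal : ∀ {m} → Vec (Fin (suc n)) m → ℕ
  numVal = Vec.foldr _ (λ d acc → toℕ d + suc n * acc) 0

  countTrue : {B : Set} → (B → Bool) → List B → ℕ
  countTrue f = foldr (λ b acc → if f b then suc acc else acc) 0

  iterate : {B : Set} → ℕ → (B → B) → B → B
  iterate zero    f b = b
  iterate (suc k) f b = f (iterate k f b)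

  eval : ∀ {Δ Γ} → Formula τ Δ Γ → RelEnv Δ → Tuple Γ → Bool
  eval (atom R xs)       Ξ ρ = rel A R (Vec.map (All.lookup ρ) xs)
  eval (eq {s = s} x y)  Ξ ρ = eqS s (All.lookup ρ x) (All.lookup ρ y)
  eval (leq x y)         Ξ ρ = toℕ (All.lookup ρ x) ≤ᵇ toℕ (All.lookup ρ y)
  eval (rvar X ts)       Ξ ρ = All.lookup Ξ X (All.map (All.lookup ρ) ts)
  eval (neg φ)           Ξ ρ = not (eval φ Ξ ρ)
  eval (conj φ ψ)        Ξ ρ = eval φ Ξ ρ ∧ eval ψ Ξ ρ
  eval (exi s φ)         Ξ ρ = any (λ a → eval φ Ξ (a ∷ ρ)) (enum s)
  eval (ifp ss φ ts)     Ξ ρ =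
    -- stages X₀ = ∅, X_{i+1} = X_i ∪ φ[X_i]; stage |tuples ss| is the
    -- inflationary fixed point
    iterate (length (tuples ss)) (λ X t → X t ∨ eval φ (X ∷ Ξ) (t ⊕ ρ)) (λ _ → false)
            (All.map (All.lookup ρ) ts)
  eval (count ss φ m νs) Ξ ρ =
    countTrue (λ t → eval φ Ξ (t ⊕ ρ)) (tuples ss) ≡ᵇ numVal (Vec.map (All.lookup ρ) νs)
  eval (rank xs ys φ m νs) Ξ ρ =
    rank₂ (length (tuples ys))
          (map (λ x → map (λ y → eval φ Ξ (x ⊕ (y ⊕ ρ))) (tuples ys)) (tuples xs))
      ≡ᵇ numVal (Vec.map (All.lookup ρ) νs)

_⊨_ : {τ : Signature} → Structure τ → Sentence τ → Set
A ⊨ φ = Semantics.eval A φ [] [] ≡ true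

-- CSP(B) is expressible in FPR₂: some sentence holds exactly in the finite
-- structures not in the class (i.e. admitting no homomorphism to B).
FPR₂-expressible-co : {τ : Signature} → (Structure τ → Set) → Set
FPR₂-expressible-co {τ} InCSP = Σ (Sentence τ) λ φ → (A : Structure τ) → (A ⊨ φ) ⇔ (¬ InCSP A)

τX : Signature
τX = record { symbols = 1 ; arity = λ _ → 3 }

X : ℚ → ℚ → ℚ → Set
X x y z = (x ≡ y × y < z) ⊎ (y ≡ z × z < x) ⊎ (z ≡ x × x < y)

HomToQX : Structure τX → Set
HomToQX A = Σ (Fin (dom A) → ℚ) λ h →
  (t : Vec (Fin (dom A)) 3) → rel A F.zero t ≡ true →
  X (h (Vec.lookup t F.zero)) (h (Vec.lookup t (F.suc F.zero))) (h (Vec.lookup t (F.suc (F.suc F.zero))))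

module Submission where

-- For a set D of discarded elements of a τX-structure, M_D is the GF(2)
-- matrix with rows the elements u, columns the triples (a,b,c), and entry
-- [u=a] ⊕ [u=b] ⊕ [u=c] when (a,b,c) ∈ R avoids D (a live constraint).  The
-- sentence ∃x ¬[ifp_{D,u} ∃ν. rk(M_D) = ν ∧ rk(M_D, row u zeroed) = ν](x)
-- discards u once its row can be zeroed without lowering the rank; by
-- Steinitz exchange, iff u lies in a set meeting every live constraint in an
-- even number of elements.  Soundness: under a homomorphism h, the live
-- elements of least h-value form such a set, so the fixed point is
-- everything.  Completeness: if it is everything, peel the stages off from
-- the last, placing each even set at value 0 below a shifted solution.

open import Data.Nat using (ℕ; zero; suc; _+_; _*_; _≤_; _<_; z≤n; s≤s; _⊔_; _≡ᵇ_)
import Data.Nat.Properties as ℕ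
open import Data.Fin as F using (Fin; toℕ; fromℕ<)
open import Data.Fin.Properties using (toℕ-fromℕ<)
open import Data.Bool using (Bool; true; false; _∧_; _∨_; not; _xor_; if_then_else_)
open import Data.Bool.Properties
  using ( T-≡; not-injective; ∧-comm; ∧-identityʳ; ∧-zeroʳ; ∧-conicalˡ; ∧-conicalʳ
        ; ∨-identityʳ; ∨-zeroʳ; ∨-conicalˡ; xor-same; xor-identityʳ; ∧-distribʳ-xor
        ; xor-∧-commutativeRing )
open import Data.Bool.ListAction using (all; any; or)
open import Data.List using (List; []; _∷_; [_]; map; foldr; length; allFin; filter; _++_; replicate; zipWith)
open import Data.List.Properties
  using ( map-++; map-∘; map-cong; map-cong-local; length-map; length-tabulate; filter-none
        ; concatMap-map; concatMap-pure )
open import Data.List.Relation.Unary.All as All using (All; []; _∷_)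
open import Data.List.Relation.Unary.All.Properties using (all⁺; all⁻)
open import Data.List.Relation.Unary.Any using (here; there)
open import Data.List.Relation.Unary.Any.Properties using (any⁺; any⁻)
open import Data.List.Relation.Unary.AllPairs using ([]; _∷_)
open import Data.List.Relation.Unary.Unique.Propositional using (Unique)
open import Data.List.Relation.Unary.Unique.Propositional.Properties using (allFin⁺)
open import Data.List.Membership.Propositional using (_∈_; find; lose)
open import Data.List.Membership.Propositional.Properties
  using (∈-map⁺; ∈-map⁻; ∈-++⁺ˡ; ∈-++⁺ʳ; ∈-++⁻; ∈-allFin; ∈-filter⁺; ∈-filter⁻; ∈-concat⁺′)
import Data.List.Membership.DecPropositional as DecMembership
open import Data.List.Relation.Binary.Sublist.Propositional
  using ([]; _∷_; _∷ʳ_; ⊆-refl; ⊆-trans) renaming (_⊆_ to _⊑_)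
open import Data.List.Relation.Binary.Sublist.Propositional.Properties
  using (filter-⊆; filter⁺; length-mono-≤; Any-resp-⊆) renaming (map⁺ to ⊑-map⁺)
import Data.Vec as Vec
open import Data.Rational as ℚ using (ℚ)
import Data.Rational.Properties as ℚₚ
open import Data.Product using (Σ; _×_; _,_; proj₁; proj₂)
open import Data.Sum using (_⊎_; inj₁; inj₂)
open import Data.Empty using (⊥-elim)
open import Function using (_∘_; case_of_; _⇔_; Equivalence; mk⇔)
open import Relation.Binary using (DecidableEquality)
open import Relation.Binary.PropositionalEquality
  using (_≡_; _≢_; refl; sym; trans; cong; cong₂; subst; module ≡-Reasoning)
open import Relation.Nullary using (¬_; does; yes; no)
open import Relation.Nullary.Decidable using (T?)
open import Algebra using (CommutativeRing; CommutativeMonoid)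
import Algebra.Properties.CommutativeSemigroup as CommutativeSemigroupProperties
open import Defs

xor≡false⇒≡ : {a b : Bool} → a xor b ≡ false → a ≡ b
xor≡false⇒≡ {true}  {true}  _ = refl
xor≡false⇒≡ {false} {false} _ = refl

true-ext : {a b : Bool} → (a ≡ true → b ≡ true) → (b ≡ true → a ≡ true) → a ≡ b
true-ext {true}  {_}     a⇒b _   = sym (a⇒b refl)
true-ext {false} {true}  _   b⇒a = b⇒a refl
true-ext {false} {false} _   _   = refl

≡ᵇ⇒≡ : {a b : ℕ} → (a ≡ᵇ b) ≡ true → a ≡ b
≡ᵇ⇒≡ h = ℕ.≡ᵇ⇒≡ _ _ (Equivalence.from T-≡ h)

≡⇒≡ᵇ : {a b : ℕ} → a ≡ b → (a ≡ᵇ b) ≡ true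
≡⇒≡ᵇ a≡b = Equivalence.to T-≡ (ℕ.≡⇒≡ᵇ _ _ a≡b)

xor-interchange : ∀ a b c d → (a xor b) xor (c xor d) ≡ (a xor c) xor (b xor d)
xor-interchange = CommutativeSemigroupProperties.interchange
  (CommutativeMonoid.commutativeSemigroup (CommutativeRing.+-commutativeMonoid xor-∧-commutativeRing))

⊕-sum : {A : Set} → (A → Bool) → List A → Bool
⊕-sum f = foldr (λ u acc → f u xor acc) false

⊕-sum-cong : {A : Set} {f g : A → Bool} (xs : List A) → (∀ u → f u ≡ g u) → ⊕-sum f xs ≡ ⊕-sum g xs
⊕-sum-cong []       f≗g = refl
⊕-sum-cong (x ∷ xs) f≗g = cong₂ _xor_ (f≗g x) (⊕-sum-cong xs f≗g)

⊕-sum-xor : {A : Set} (f g : A → Bool) (xs : List A) →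
  ⊕-sum (λ u → f u xor g u) xs ≡ ⊕-sum f xs xor ⊕-sum g xs
⊕-sum-xor f g []       = refl
⊕-sum-xor f g (x ∷ xs) rewrite ⊕-sum-xor f g xs = xor-interchange (f x) (g x) (⊕-sum f xs) (⊕-sum g xs)

⊕-sum-zero : {A : Set} (f : A → Bool) {xs : List A} → All (λ u → f u ≡ false) xs → ⊕-sum f xs ≡ false
⊕-sum-zero f []           = refl
⊕-sum-zero f (fx≡0 ∷ f≡0) rewrite fx≡0 = ⊕-sum-zero f f≡0

module _ {A : Set} (p : A → Bool) where

  all-elim : {xs : List A} → all p xs ≡ true → ∀ {x} → x ∈ xs → p x ≡ true
  all-elim {xs} h x∈xs = Equivalence.to T-≡ (All.lookup (all⁺ p xs (Equivalence.from T-≡ h)) x∈xs)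

  all-intro : {xs : List A} → (∀ {x} → x ∈ xs → p x ≡ true) → all p xs ≡ true
  all-intro h = Equivalence.to T-≡ (all⁻ p (All.tabulate (Equivalence.from T-≡ ∘ h)))

  all-counterexample : (xs : List A) → all p xs ≡ false → Σ A λ x → x ∈ xs × p x ≡ false
  all-counterexample (x ∷ xs) h with p x in px
  ... | false = x , here refl , px
  ... | true  = let y , y∈xs , py = all-counterexample xs h in y , there y∈xs , py

  any-elim : {xs : List A} → any p xs ≡ true → Σ A λ x → x ∈ xs × p x ≡ true
  any-elim {xs} h = let x , x∈xs , px = find (any⁻ p xs (Equivalence.from T-≡ h)) in
                    x , x∈xs , Equivalence.to T-≡ px

  any-intro : {xs : List A} {x : A} → x ∈ xs → p x ≡ true → any p xs ≡ true
  any-intro x∈xs px = Equivalence.to T-≡ (any⁺ p (lose x∈xs (Equivalence.from T-≡ px)))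

maxOver : {A : Set} → (A → ℕ) → List A → ℕ
maxOver f = foldr (λ x acc → f x ⊔ acc) 0

maxOver-upper : {A : Set} (f : A → ℕ) {xs : List A} {x : A} → x ∈ xs → f x ≤ maxOver f xs
maxOver-upper f {y ∷ xs} (here refl)  = ℕ.m≤m⊔n (f y) _
maxOver-upper f {y ∷ xs} (there x∈xs) = ℕ.≤-trans (maxOver-upper f x∈xs) (ℕ.m≤n⊔m (f y) _)

maxOver-attained : {A : Set} (f : A → ℕ) (xs : List A) →
  maxOver f xs ≡ 0 ⊎ Σ A λ x → x ∈ xs × f x ≡ maxOver f xs
maxOver-attained f []       = inj₁ refl
maxOver-attained f (y ∷ xs) with ℕ.⊔-sel (f y) (maxOver f xs) | maxOver-attained f xs
... | inj₁ max≡fy | _                        = inj₂ (y , here refl , sym max≡fy)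
... | inj₂ max≡ih | inj₁ ih≡0                = inj₁ (trans max≡ih ih≡0)
... | inj₂ max≡ih | inj₂ (x , x∈xs , fx≡ih) = inj₂ (x , there x∈xs , trans fx≡ih (sym max≡ih))

select : {A : Set} → (A → Bool) → List A → List A
select p = filter (T? ∘ p)

module _ {A : Set} {p : A → Bool} where

  ∈-select⁺ : {xs : List A} {u : A} → u ∈ xs → p u ≡ true → u ∈ select p xs
  ∈-select⁺ u∈xs pu = ∈-filter⁺ (T? ∘ p) u∈xs (Equivalence.from T-≡ pu)

  ∈-select⁻ : {xs : List A} {u : A} → u ∈ select p xs → p u ≡ true
  ∈-select⁻ {xs} u∈sel = Equivalence.to T-≡ (proj₂ (∈-filter⁻ (T? ∘ p) {xs = xs} u∈sel))

  select-⊑ : (xs : List A) → select p xs ⊑ xs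
  select-⊑ = filter-⊆ (T? ∘ p)

  select-mono : {q : A → Bool} {xs : List A} → (∀ u → q u ≡ true → p u ≡ true) → select q xs ⊑ select p xs
  select-mono {q} {xs} q⇒p = filter⁺ (T? ∘ q) (T? ∘ p)
    (λ { {u} refl qu → Equivalence.from T-≡ (q⇒p u (Equivalence.to T-≡ qu)) }) (⊆-refl {x = xs})

  select-cong : {q : A → Bool} {xs : List A} → All (λ u → p u ≡ q u) xs → select p xs ≡ select q xs
  select-cong {xs = []}             []            = refl
  select-cong {q = q} {xs = x ∷ xs} (px≡qx ∷ p≗q) with p x | q x | px≡qx
  ... | true  | .true  | refl = cong (x ∷_) (select-cong p≗q)
  ... | false | .false | refl = select-cong p≗q

module _ {A : Set} (_≟_ : DecidableEquality A) where
  open DecMembership _≟_ using (_∈?_)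

  private
    select-sublist : (q : A → Bool) {xs ys : List A} → Unique ys → xs ⊑ ys →
      (∀ {u} → u ∈ ys → q u ≡ true ⇔ u ∈ xs) → select q ys ≡ xs
    select-sublist q _ [] _ = refl
    select-sublist q {ys = y ∷ ys} (y∉ys ∷ uys) (y ∷ʳ xs⊑ys) q⇔ with q y in qy
    ... | true  = ⊥-elim (All.lookup y∉ys (Any-resp-⊆ xs⊑ys (Equivalence.to (q⇔ (here refl)) qy)) refl)
    ... | false = select-sublist q uys xs⊑ys (q⇔ ∘ there)
    select-sublist q {xs = y ∷ xs} {ys = y ∷ ys} (y∉ys ∷ uys) (refl ∷ xs⊑ys) q⇔ with q y in qy
    ... | true  = cong (y ∷_) (select-sublist q uys xs⊑ys q⇔′)
      where
      q⇔′ : ∀ {u} → u ∈ ys → q u ≡ true ⇔ u ∈ xs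
      q⇔′ {u} u∈ys = mk⇔ (λ qu → drop (Equivalence.to (q⇔ (there u∈ys)) qu))
                         (λ u∈xs → Equivalence.from (q⇔ (there u∈ys)) (there u∈xs))
        where
        drop : u ∈ y ∷ xs → u ∈ xs
        drop (here u≡y)   = ⊥-elim (All.lookup y∉ys u∈ys (sym u≡y))
        drop (there u∈xs) = u∈xs
    ... | false with () ← trans (sym qy) (Equivalence.from (q⇔ (here refl)) (here refl))

  sublist-selection : {xs ys : List A} → Unique ys → xs ⊑ ys →
    Σ (A → Bool) λ q → select q ys ≡ xs × (∀ u → q u ≡ true → u ∈ xs)
  sublist-selection {xs} uys xs⊑ys =
    (λ u → does (u ∈? xs)) , select-sublist _ uys xs⊑ys (λ _ → ∈?-⇔) , λ u → Equivalence.to ∈?-⇔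
    where
    ∈?-⇔ : ∀ {u} → does (u ∈? xs) ≡ true ⇔ u ∈ xs
    ∈?-⇔ {u} with u ∈? xs
    ... | yes u∈xs = mk⇔ (λ _ → u∈xs) (λ _ → refl)
    ... | no  u∉xs = mk⇔ (λ ()) (λ u∈xs → ⊥-elim (u∉xs u∈xs))

module _ {A : Set} where

  ⊑⇒∈subsequences : {xs ys : List A} → xs ⊑ ys → xs ∈ subsequences ys
  ⊑⇒∈subsequences []             = here refl
  ⊑⇒∈subsequences (refl ∷ xs⊑ys) = ∈-++⁺ˡ (∈-map⁺ _ (⊑⇒∈subsequences xs⊑ys))
  ⊑⇒∈subsequences {ys = y ∷ ys} (_ ∷ʳ xs⊑ys) =
    ∈-++⁺ʳ (map (y ∷_) (subsequences ys)) (⊑⇒∈subsequences xs⊑ys)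

  ∈subsequences⇒⊑ : {xs : List A} (ys : List A) → xs ∈ subsequences ys → xs ⊑ ys
  ∈subsequences⇒⊑ []       (here refl) = []
  ∈subsequences⇒⊑ (y ∷ ys) xs∈ with ∈-++⁻ (map (y ∷_) (subsequences ys)) xs∈
  ... | inj₁ xs∈keep with ∈-map⁻ (y ∷_) xs∈keep
  ...   | _ , xs′∈ , refl = refl ∷ ∈subsequences⇒⊑ ys xs′∈
  ∈subsequences⇒⊑ (y ∷ ys) xs∈ | inj₂ xs∈skip = y ∷ʳ ∈subsequences⇒⊑ ys xs∈skip

subsequences-map : {A B : Set} (f : A → B) (xs : List A) →
  subsequences (map f xs) ≡ map (map f) (subsequences xs)
subsequences-map f []       = refl
subsequences-map f (x ∷ xs) = begin
  map (f x ∷_) (subsequences (map f xs)) ++ subsequences (map f xs)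
    ≡⟨ cong (λ r → map (f x ∷_) r ++ r) (subsequences-map f xs) ⟩
  map (f x ∷_) (map (map f) ss) ++ map (map f) ss
    ≡⟨ cong (_++ map (map f) ss) (trans (sym (map-∘ ss)) (map-∘ ss)) ⟩
  map (map f) (map (x ∷_) ss) ++ map (map f) ss
    ≡⟨ sym (map-++ (map f) (map (x ∷_) ss) ss) ⟩
  map (map f) (map (x ∷_) ss ++ ss) ∎
  where
  open ≡-Reasoning
  ss = subsequences xs

Subset : ℕ → Set
Subset n = Fin n → Bool

_⊆_ : {n : ℕ} → Subset n → Subset n → Set
q ⊆ p = ∀ u → q u ≡ true → p u ≡ true

Nonempty : {n : ℕ} → Subset n → Set
Nonempty q = Σ _ λ u → q u ≡ true

_∪_ : {n : ℕ} → Subset n → Subset n → Subset n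
(p ∪ q) u = p u ∨ q u

_∖_ : {n : ℕ} → Subset n → Subset n → Subset n
(p ∖ q) u = p u ∧ not (q u)

⟦_⟧ : {n : ℕ} → Fin n → Subset n
⟦ v ⟧ u = does (u F.≟ v)

⟦⟧-sound : {n : ℕ} {v u : Fin n} → ⟦ v ⟧ u ≡ true → u ≡ v
⟦⟧-sound {v = v} {u} h with u F.≟ v
... | yes u≡v = u≡v

⟦⟧-refl : {n : ℕ} (v : Fin n) → ⟦ v ⟧ v ≡ true
⟦⟧-refl v with v F.≟ v
... | yes _   = refl
... | no v≢v = ⊥-elim (v≢v refl)

⟦⟧-other : {n : ℕ} {v u : Fin n} → v ≢ u → ⟦ v ⟧ u ≡ false
⟦⟧-other {v = v} {u} v≢u with u F.≟ v
... | yes u≡v = ⊥-elim (v≢u (sym u≡v))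
... | no _    = refl

⊕-sum-point : {n : ℕ} (v : Fin n) (f : Fin n → Bool) {xs : List (Fin n)} → Unique xs → v ∈ xs →
  ⊕-sum (λ u → ⟦ v ⟧ u ∧ f u) xs ≡ f v
⊕-sum-point v f {x ∷ xs} (x∉xs ∷ _) (here refl)
  rewrite ⟦⟧-refl v | ⊕-sum-zero (λ u → ⟦ v ⟧ u ∧ f u) (All.map (λ v≢u → cong (_∧ f _) (⟦⟧-other v≢u)) x∉xs) =
  xor-identityʳ (f v)
⊕-sum-point v f {x ∷ xs} (x∉xs ∷ uxs) (there v∈xs) with x F.≟ v
... | yes refl = ⊥-elim (All.lookup x∉xs v∈xs refl)
... | no _     = ⊕-sum-point v f uxs v∈xs

module _ {n : ℕ} where

  members : Subset n → List (Fin n)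
  members p = select p (allFin n)

  ∣_∣ : Subset n → ℕ
  ∣ p ∣ = length (members p)

  ∈-members⁺ : {p : Subset n} (u : Fin n) → p u ≡ true → u ∈ members p
  ∈-members⁺ u = ∈-select⁺ (∈-allFin u)

  ∈-members⁻ : {p : Subset n} {u : Fin n} → u ∈ members p → p u ≡ true
  ∈-members⁻ = ∈-select⁻ {xs = allFin n}

  members-∅ : members (λ (_ : Fin n) → false) ≡ []
  members-∅ = filter-none (T? ∘ λ _ → false) {xs = allFin n} (All.tabulate λ _ ())

  sublist-is-members : {xs : List (Fin n)} → xs ⊑ allFin n →
    Σ (Subset n) λ q → xs ≡ members q × (∀ u → q u ≡ true → u ∈ xs)
  sublist-is-members xs⊑all with sublist-selection F._≟_ (allFin⁺ n) xs⊑all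
  ... | q , members-q≡xs , q⇒∈xs = q , sym members-q≡xs , q⇒∈xs

  sublist-of-members : {p : Subset n} {xs : List (Fin n)} → xs ⊑ members p →
    Σ (Subset n) λ q → q ⊆ p × xs ≡ members q
  sublist-of-members {p} xs⊑p with sublist-is-members (⊆-trans xs⊑p (select-⊑ (allFin n)))
  ... | q , xs≡members-q , q⇒∈xs = q , (λ u qu → ∈-members⁻ (Any-resp-⊆ xs⊑p (q⇒∈xs u qu))) , xs≡members-q

  ∣∣-cong : {p q : Subset n} → (∀ u → p u ≡ q u) → ∣ p ∣ ≡ ∣ q ∣
  ∣∣-cong p≗q = cong length (select-cong {xs = allFin n} (All.tabulate λ {u} _ → p≗q u))

  ∣∣-mono : {p q : Subset n} → q ⊆ p → ∣ q ∣ ≤ ∣ p ∣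
  ∣∣-mono q⊆p = length-mono-≤ (select-mono {xs = allFin n} q⊆p)

  ∣∣≤n : (p : Subset n) → ∣ p ∣ ≤ n
  ∣∣≤n p = subst (∣ p ∣ ≤_) (length-tabulate (λ u → u)) (length-mono-≤ (select-⊑ (allFin n)))

  private
    select-insert : (p : Subset n) (v : Fin n) {xs : List (Fin n)} → Unique xs → v ∈ xs → p v ≡ false →
      length (select (p ∪ ⟦ v ⟧) xs) ≡ suc (length (select p xs))
    select-insert p v {x ∷ xs} (x∉xs ∷ _) (here refl) pv rewrite pv | ⟦⟧-refl v =
      cong (suc ∘ length) (select-cong (All.map (λ x≢u → p∪v≡p (⟦⟧-other x≢u)) x∉xs))
      where
      p∪v≡p : ∀ {u} → ⟦ v ⟧ u ≡ false → (p ∪ ⟦ v ⟧) u ≡ p u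
      p∪v≡p {u} u≢v = trans (cong (p u ∨_) u≢v) (∨-identityʳ (p u))
    select-insert p v {x ∷ xs} (x∉xs ∷ uxs) (there v∈xs) pv with x F.≟ v
    ... | yes refl = ⊥-elim (All.lookup x∉xs v∈xs refl)
    ... | no _ with p x
    ...   | true  = cong suc (select-insert p v uxs v∈xs pv)
    ...   | false = select-insert p v uxs v∈xs pv

  ∣∣-insert : (p : Subset n) (v : Fin n) → p v ≡ false → ∣ p ∪ ⟦ v ⟧ ∣ ≡ suc ∣ p ∣
  ∣∣-insert p v = select-insert p v (allFin⁺ n) (∈-allFin v)

  ∣∣-swap : {t : Subset n} {v u : Fin n} → t v ≡ true → t u ≡ false →
    ∣ (t ∖ ⟦ v ⟧) ∪ ⟦ u ⟧ ∣ ≡ ∣ t ∣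
  ∣∣-swap {t} {v} {u} tv tu = begin
    ∣ (t ∖ ⟦ v ⟧) ∪ ⟦ u ⟧ ∣  ≡⟨ ∣∣-insert (t ∖ ⟦ v ⟧) u (cong (_∧ _) tu) ⟩
    suc ∣ t ∖ ⟦ v ⟧ ∣        ≡⟨ sym (∣∣-insert (t ∖ ⟦ v ⟧) v v∉t∖v) ⟩
    ∣ (t ∖ ⟦ v ⟧) ∪ ⟦ v ⟧ ∣  ≡⟨ ∣∣-cong t∖v∪v≗t ⟩
    ∣ t ∣                    ∎
    where
    open ≡-Reasoning
    v∉t∖v : (t ∖ ⟦ v ⟧) v ≡ false
    v∉t∖v = trans (cong (λ b → t v ∧ not b) (⟦⟧-refl v)) (∧-zeroʳ (t v))
    t∖v∪v≗t : ∀ w → ((t ∖ ⟦ v ⟧) ∪ ⟦ v ⟧) w ≡ t w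
    t∖v∪v≗t w with ⟦ v ⟧ w in w≡v
    ... | true  = trans (∨-zeroʳ _) (sym (subst (λ y → t y ≡ true) (sym (⟦⟧-sound w≡v)) tv))
    ... | false = trans (∨-identityʳ _) (∧-identityʳ (t w))

  ∣∣-strict : {p q : Subset n} (w : Fin n) → q ⊆ p → q w ≡ false → p w ≡ true → suc ∣ q ∣ ≤ ∣ p ∣
  ∣∣-strict {p} {q} w q⊆p qw pw = subst (_≤ ∣ p ∣) (∣∣-insert q w qw) (∣∣-mono q∪w⊆p)
    where
    q∪w⊆p : (q ∪ ⟦ w ⟧) ⊆ p
    q∪w⊆p u qu∨u≡w with q u in qu
    ... | true  = q⊆p u qu
    ... | false = subst (λ x → p x ≡ true) (sym (⟦⟧-sound qu∨u≡w)) pw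

  ∣∣-full : (p : Subset n) → n ≤ ∣ p ∣ → ∀ u → p u ≡ true
  ∣∣-full p n≤∣p∣ u with p u in pu
  ... | true  = refl
  ... | false = ⊥-elim (ℕ.<-irrefl refl (begin-strict
    n                ≤⟨ n≤∣p∣ ⟩
    ∣ p ∣            <⟨ ∣∣-strict u (λ _ _ → refl) pu refl ⟩
    ∣ (λ _ → true) ∣ ≤⟨ ∣∣≤n _ ⟩
    n                ∎))
    where open ℕ.≤-Reasoning

  nonempty? : (p : Subset n) → Nonempty p ⊎ (∀ u → p u ≡ false)
  nonempty? p with any p (allFin n) in some
  ... | true  = let u , _ , pu = any-elim p {allFin n} some in inj₁ (u , pu)
  ... | false = inj₂ none
    where
    none : ∀ u → p u ≡ false
    none u with p u in pu
    ... | false = refl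
    ... | true  with () ← trans (sym some) (any-intro p (∈-allFin u) pu)

module RowSpace {n : ℕ} {Col : Set} (cols : List Col) (E : Fin n → Col → Bool) where

  width : ℕ
  width = length cols

  row : Fin n → List Bool
  row u = map (E u) cols

  rowsOf : Subset n → List (List Bool)
  rowsOf p = map row (members p)

  rk : ℕ
  rk = rank₂ width (map row (allFin n))

  sumAt : Subset n → Col → Bool
  sumAt q c = ⊕-sum (λ u → q u ∧ E u c) (allFin n)

  SumsTo : Subset n → (Col → Bool) → Set
  SumsTo q F = ∀ c → c ∈ cols → sumAt q c ≡ F c

  Dependency : Subset n → Set
  Dependency q = Nonempty q × SumsTo q (λ _ → false)

  Independent : Subset n → Set
  Independent p = independent₂ width (rowsOf p) ≡ true

  private
    zipWith-xor-map : (f g : Col → Bool) (cs : List Col) →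
      zipWith _xor_ (map f cs) (map g cs) ≡ map (λ c → f c xor g c) cs
    zipWith-xor-map f g []       = refl
    zipWith-xor-map f g (c ∷ cs) = cong (_ ∷_) (zipWith-xor-map f g cs)

    replicate-false : (cs : List Col) → replicate (length cs) false ≡ map (λ _ → false) cs
    replicate-false []       = refl
    replicate-false (c ∷ cs) = cong (false ∷_) (replicate-false cs)

    vsum-map-row : (us : List (Fin n)) →
      vsum width (map row us) ≡ map (λ c → ⊕-sum (λ u → E u c) us) cols
    vsum-map-row []       = replicate-false cols
    vsum-map-row (u ∷ us) rewrite vsum-map-row us = zipWith-xor-map (E u) _ cols

    ⊕-sum-select : (q : Subset n) (c : Col) (xs : List (Fin n)) →
      ⊕-sum (λ u → E u c) (select q xs) ≡ ⊕-sum (λ u → q u ∧ E u c) xs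
    ⊕-sum-select q c []       = refl
    ⊕-sum-select q c (x ∷ xs) with q x
    ... | true  = cong (E x c xor_) (⊕-sum-select q c xs)
    ... | false = ⊕-sum-select q c xs

  vsum-rowsOf : (q : Subset n) → vsum width (rowsOf q) ≡ map (sumAt q) cols
  vsum-rowsOf q = trans (vsum-map-row (members q)) (map-cong (λ c → ⊕-sum-select q c (allFin n)) cols)

  test : List (List Bool) → Bool
  test s = not (nonEmpty s) ∨ not (isZeroVec (vsum width s))

  private
    nonEmpty-rowsOf⁺ : {q : Subset n} → Nonempty q → nonEmpty (rowsOf q) ≡ true
    nonEmpty-rowsOf⁺ {q} (u , qu) with members q | ∈-members⁺ {p = q} u qu
    ... | _ ∷ _ | _ = refl

    nonEmpty-rowsOf⁻ : {q : Subset n} → nonEmpty (rowsOf q) ≡ true → Nonempty q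
    nonEmpty-rowsOf⁻ {q} h with members q in mq
    nonEmpty-rowsOf⁻ {q} () | []
    ... | u ∷ _ = u , ∈-members⁻ (subst (u ∈_) (sym mq) (here refl))

    isZeroVec⁺ : (F : Col → Bool) → (∀ c → c ∈ cols → F c ≡ false) → isZeroVec (map F cols) ≡ true
    isZeroVec⁺ F F≡0 = all-intro not λ x∈ → let c , c∈ , x≡Fc = ∈-map⁻ F x∈ in
      subst (λ x → not x ≡ true) (sym x≡Fc) (cong not (F≡0 c c∈))

    isZeroVec⁻ : (F : Col → Bool) → isZeroVec (map F cols) ≡ true → ∀ c → c ∈ cols → F c ≡ false
    isZeroVec⁻ F all0 c c∈ with F c in Fc | all-elim not all0 (∈-map⁺ F c∈)
    ... | false | _ = refl

  dependency⇒test : {q : Subset n} → Dependency q → test (rowsOf q) ≡ false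
  dependency⇒test {q} (q≠∅ , sum≡0)
    rewrite nonEmpty-rowsOf⁺ q≠∅ | vsum-rowsOf q | isZeroVec⁺ (sumAt q) sum≡0 = refl

  test⇒dependency : {q : Subset n} → test (rowsOf q) ≡ false → Dependency q
  test⇒dependency {q} h with nonEmpty (rowsOf q) in ne | isZeroVec (vsum width (rowsOf q)) in sum≡0
  ... | true | true = nonEmpty-rowsOf⁻ ne ,
                      isZeroVec⁻ (sumAt q) (subst (λ v → isZeroVec v ≡ true) (vsum-rowsOf q) sum≡0)

  independent⇒no-dependency : {p q : Subset n} → Independent p → q ⊆ p → ¬ Dependency q
  independent⇒no-dependency {p} {q} indep q⊆p dep
    with () ← trans (sym (dependency⇒test dep))
                    (all-elim test indep (⊑⇒∈subsequences (⊑-map⁺ row (select-mono {xs = allFin n} q⊆p))))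

  dependent⇒dependency : {p : Subset n} → independent₂ width (rowsOf p) ≡ false →
    Σ (Subset n) λ q → q ⊆ p × Dependency q
  dependent⇒dependency {p} h with all-counterexample test (subsequences (rowsOf p)) h
  ... | s , s∈ , test-s with ∈-map⁻ (map row) (subst (s ∈_) (subsequences-map row (members p)) s∈)
  ... | xs , xs∈ , refl with sublist-of-members (∈subsequences⇒⊑ (members p) xs∈)
  ... | q , q⊆p , refl = q , q⊆p , test⇒dependency test-s

  ∅-independent : Independent (λ _ → false)
  ∅-independent rewrite members-∅ {n} = refl

  score : List (List Bool) → ℕ
  score s = if independent₂ width s then length s else 0

  rk-upper : {p : Subset n} → Independent p → ∣ p ∣ ≤ rk
  rk-upper {p} indep = ℕ.≤-trans ∣p∣≤score
    (maxOver-upper score (⊑⇒∈subsequences (⊑-map⁺ row (select-⊑ {p = p} (allFin n)))))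
    where
    ∣p∣≤score : ∣ p ∣ ≤ score (rowsOf p)
    ∣p∣≤score rewrite indep | length-map row (members p) = ℕ.≤-refl

  rk-attained : Σ (Subset n) λ p → Independent p × ∣ p ∣ ≡ rk
  rk-attained with maxOver-attained score (subsequences (map row (allFin n)))
  ... | inj₁ rk≡0 = (λ _ → false) , ∅-independent , trans (cong length (members-∅ {n})) (sym rk≡0)
  ... | inj₂ (s , s∈ , score≡rk) with ∈-map⁻ (map row) (subst (s ∈_) (subsequences-map row (allFin n)) s∈)
  ... | xs , xs∈ , refl with sublist-is-members (∈subsequences⇒⊑ (allFin n) xs∈)
  ... | q , refl , _ with independent₂ width (rowsOf q) in indep
  ... | true  = q , indep , trans (sym (length-map row (members q))) score≡rk
  ... | false = (λ _ → false) , ∅-independent , trans (cong length (members-∅ {n})) score≡rk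

  rk≤n : rk ≤ n
  rk≤n = let p , _ , ∣p∣≡rk = rk-attained in subst (_≤ n) ∣p∣≡rk (∣∣≤n p)

  sumAt-cong : {q r : Subset n} → (∀ u → q u ≡ r u) → (c : Col) → sumAt q c ≡ sumAt r c
  sumAt-cong q≗r c = ⊕-sum-cong (allFin n) (λ u → cong (_∧ E u c) (q≗r u))

  sumAt-xor : (q r : Subset n) (c : Col) → sumAt (λ w → q w xor r w) c ≡ sumAt q c xor sumAt r c
  sumAt-xor q r c = trans (⊕-sum-cong (allFin n) (λ u → ∧-distribʳ-xor (E u c) (q u) (r u)))
                          (⊕-sum-xor (λ u → q u ∧ E u c) (λ u → r u ∧ E u c) (allFin n))

  sumAt-⟦⟧ : (x : Fin n) (c : Col) → sumAt ⟦ x ⟧ c ≡ E x c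
  sumAt-⟦⟧ x c = ⊕-sum-point x (λ u → E u c) (allFin⁺ n) (∈-allFin x)

  sumAt-split : {q : Subset n} {x : Fin n} → q x ≡ true → (c : Col) →
    sumAt q c ≡ sumAt (q ∖ ⟦ x ⟧) c xor E x c
  sumAt-split {q} {x} qx c = begin
    sumAt q c                                            ≡⟨ sumAt-cong split c ⟩
    sumAt (λ w → (q ∖ ⟦ x ⟧) w xor ⟦ x ⟧ w) c           ≡⟨ sumAt-xor (q ∖ ⟦ x ⟧) ⟦ x ⟧ c ⟩
    sumAt (q ∖ ⟦ x ⟧) c xor sumAt ⟦ x ⟧ c               ≡⟨ cong (sumAt (q ∖ ⟦ x ⟧) c xor_) (sumAt-⟦⟧ x c) ⟩
    sumAt (q ∖ ⟦ x ⟧) c xor E x c                        ∎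
    where
    open ≡-Reasoning
    split : ∀ w → q w ≡ (q ∖ ⟦ x ⟧) w xor ⟦ x ⟧ w
    split w with ⟦ x ⟧ w in w≡x
    ... | true  = trans (subst (λ y → q y ≡ true) (sym (⟦⟧-sound w≡x)) qx)
                        (cong (_xor true) (sym (∧-zeroʳ (q w))))
    ... | false = sym (trans (xor-identityʳ _) (∧-identityʳ (q w)))

  dependency-minus : {q : Subset n} {x : Fin n} → Dependency q → q x ≡ true → SumsTo (q ∖ ⟦ x ⟧) (E x)
  dependency-minus {q} (_ , q→0) qx c c∈ = xor≡false⇒≡ (trans (sym (sumAt-split {q} qx c)) (q→0 c c∈))

  -- Let t be independent, v ∈ t, and S a dependency
  -- containing v.  Some row u ∉ t can replace v in t.  Otherwise every row is
  -- a sum of rows of B = t ∖ {v}: rows of t trivially, and a row x ∉ t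
  -- because B ∪ {x} is dependent.  Then row v, the sum of S ∖ {v}, is a sum
  -- of rows of B, which gives a dependency inside t.
  module Exchange {t S : Subset n} {v : Fin n} (t-indep : Independent t) (tv : t v ≡ true)
                  (S-dep : Dependency S) (Sv : S v ≡ true) where

    B : Subset n
    B = t ∖ ⟦ v ⟧

    InSpan : (Col → Bool) → Set
    InSpan F = Σ (Subset n) λ Q → Q ⊆ B × SumsTo Q F

    Exchanged : Set
    Exchanged = Σ (Fin n) λ u → t u ≡ false × Independent (B ∪ ⟦ u ⟧)

    span-∅ : InSpan (λ _ → false)
    span-∅ = (λ _ → false) , (λ _ ()) , λ c _ →
      ⊕-sum-zero (λ u → false ∧ E u c) {allFin n} (All.tabulate λ _ → refl)

    span-xor : {F G : Col → Bool} → InSpan F → InSpan G → InSpan (λ c → F c xor G c)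
    span-xor (Q , Q⊆B , Q→F) (R , R⊆B , R→G) =
      (λ w → Q w xor R w) , Q⊕R⊆B , λ c c∈ → trans (sumAt-xor Q R c) (cong₂ _xor_ (Q→F c c∈) (R→G c c∈))
      where
      Q⊕R⊆B : (λ w → Q w xor R w) ⊆ B
      Q⊕R⊆B w h with Q w in Qw
      ... | true  = Q⊆B w Qw
      ... | false = R⊆B w h

    row-in-span : (x : Fin n) → ⟦ v ⟧ x ≡ false → Exchanged ⊎ InSpan (E x)
    row-in-span x x≢v with t x in tx
    ... | true  = inj₂ (⟦ x ⟧ , ⟦x⟧⊆B , λ c _ → sumAt-⟦⟧ x c)
      where
      ⟦x⟧⊆B : ⟦ x ⟧ ⊆ B
      ⟦x⟧⊆B w w≡x rewrite ⟦⟧-sound {v = x} {u = w} w≡x | tx | x≢v = refl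
    ... | false with independent₂ width (rowsOf (B ∪ ⟦ x ⟧)) in indep
    ...   | true  = inj₁ (x , tx , indep)
    ...   | false with dependent⇒dependency indep
    ...     | q , q⊆B∪x , q-dep with q x in qx
    ...       | true  = inj₂ ((q ∖ ⟦ x ⟧) , q∖x⊆B , dependency-minus q-dep qx)
      where
      q∖x⊆B : (q ∖ ⟦ x ⟧) ⊆ B
      q∖x⊆B w h with ⟦ x ⟧ w | q⊆B∪x w (∧-conicalˡ _ _ h) | h
      ... | false | B∪false | _  = trans (sym (∨-identityʳ _)) B∪false
      ... | true  | _       | h′ with () ← ∧-conicalʳ (q w) false h′
    ...       | false = ⊥-elim (independent⇒no-dependency t-indep q⊆t q-dep)
      where
      q⊆t : q ⊆ t
      q⊆t w qw with B w in Bw | q⊆B∪x w qw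
      ... | true  | _   = ∧-conicalˡ _ _ Bw
      ... | false | w≡x with () ← trans (sym qx) (subst (λ y → q y ≡ true) (⟦⟧-sound w≡x) qw)

    partial-sums-in-span : (xs : List (Fin n)) →
      Exchanged ⊎ InSpan (λ c → ⊕-sum (λ u → (S ∖ ⟦ v ⟧) u ∧ E u c) xs)
    partial-sums-in-span [] = inj₂ span-∅
    partial-sums-in-span (x ∷ xs) with S x ∧ not (⟦ v ⟧ x) in Sx | partial-sums-in-span xs
    ... | _     | inj₁ ex = inj₁ ex
    ... | false | inj₂ sp = inj₂ sp
    ... | true  | inj₂ sp with row-in-span x (not-injective (∧-conicalʳ (S x) _ Sx))
    ...   | inj₁ ex  = inj₁ ex
    ...   | inj₂ spx = inj₂ (span-xor spx sp)

    exchanged : Exchanged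
    exchanged with partial-sums-in-span (allFin n)
    ... | inj₁ ex = ex
    ... | inj₂ (Q , Q⊆B , Q→v) = ⊥-elim (independent⇒no-dependency t-indep Q+v⊆t ((v , Q+v∋v) , Q+v→0))
      where
      Q+v : Subset n
      Q+v w = Q w xor ⟦ v ⟧ w
      Qv : Q v ≡ false
      Qv with Q v in Qv
      ... | false = refl
      ... | true  with () ← trans (sym (cong not (⟦⟧-refl v))) (∧-conicalʳ (t v) _ (Q⊆B v Qv))
      Q+v∋v : Q+v v ≡ true
      Q+v∋v rewrite Qv = ⟦⟧-refl v
      Q+v⊆t : Q+v ⊆ t
      Q+v⊆t w h with Q w in Qw
      ... | true  = ∧-conicalˡ _ _ (Q⊆B w Qw)
      ... | false = subst (λ y → t y ≡ true) (sym (⟦⟧-sound h)) tv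
      Q+v→0 : SumsTo Q+v (λ _ → false)
      Q+v→0 c c∈ = begin
        sumAt Q+v c                    ≡⟨ sumAt-xor Q ⟦ v ⟧ c ⟩
        sumAt Q c xor sumAt ⟦ v ⟧ c    ≡⟨ cong₂ _xor_ (Q→v c c∈) (sumAt-⟦⟧ v c) ⟩
        sumAt (S ∖ ⟦ v ⟧) c xor E v c  ≡⟨ cong (_xor E v c) (dependency-minus S-dep Sv c c∈) ⟩
        E v c xor E v c                ≡⟨ xor-same (E v c) ⟩
        false                          ∎
        where open ≡-Reasoning

  exchange : {t S : Subset n} {v : Fin n} → Independent t → t v ≡ true → Dependency S → S v ≡ true →
    Σ (Fin n) λ u → t u ≡ false × Independent ((t ∖ ⟦ v ⟧) ∪ ⟦ u ⟧)
  exchange t-indep tv S-dep Sv = Exchange.exchanged t-indep tv S-dep Sv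

module DeleteRow {n : ℕ} {Col : Set} (cols : List Col) (E : Fin n → Col → Bool) (v : Fin n) where

  E∖v : Fin n → Col → Bool
  E∖v u c = E u c ∧ not (⟦ v ⟧ u)

  module M  = RowSpace cols E
  module M∖v = RowSpace cols E∖v

  private
    entries-avoiding : {u : Fin n} → ⟦ v ⟧ u ≡ false → ∀ c → E∖v u c ≡ E u c
    entries-avoiding u≢v c rewrite u≢v = ∧-identityʳ _

    avoids : {p : Subset n} {u : Fin n} → p v ≡ false → p u ≡ true → ⟦ v ⟧ u ≡ false
    avoids {p} {u} pv pu with ⟦ v ⟧ u in u≡v
    ... | false = refl
    ... | true with () ← trans (sym pv) (subst (λ y → p y ≡ true) (⟦⟧-sound u≡v) pu)

  rowsOf-avoiding : {p : Subset n} → p v ≡ false → M∖v.rowsOf p ≡ M.rowsOf p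
  rowsOf-avoiding {p} pv = map-cong-local (All.tabulate λ u∈ →
    map-cong (entries-avoiding (avoids {p} pv (∈-members⁻ u∈))) cols)

  sumAt-avoiding : {q : Subset n} → q v ≡ false → ∀ c → M∖v.sumAt q c ≡ M.sumAt q c
  sumAt-avoiding {q} qv c = ⊕-sum-cong (allFin n) summand
    where
    summand : ∀ u → q u ∧ E∖v u c ≡ q u ∧ E u c
    summand u with q u in qu
    ... | false = refl
    ... | true  = entries-avoiding (avoids {q} qv qu) c

  independent-avoiding⁺ : {p : Subset n} → p v ≡ false → M.Independent p → M∖v.Independent p
  independent-avoiding⁺ {p} pv = subst (λ rs → independent₂ M.width rs ≡ true) (sym (rowsOf-avoiding {p} pv))

  independent-avoiding⁻ : {p : Subset n} → p v ≡ false → M∖v.Independent p → M.Independent p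
  independent-avoiding⁻ {p} pv = subst (λ rs → independent₂ M.width rs ≡ true) (rowsOf-avoiding {p} pv)

  independent-avoids-v : {p : Subset n} → M∖v.Independent p → p v ≡ false
  independent-avoids-v {p} indep with p v in pv
  ... | false = refl
  ... | true  = ⊥-elim (M∖v.independent⇒no-dependency indep v⊆p ((v , ⟦⟧-refl v) , row-v-zero))
    where
    v⊆p : ⟦ v ⟧ ⊆ p
    v⊆p u u≡v = subst (λ y → p y ≡ true) (sym (⟦⟧-sound u≡v)) pv
    row-v-zero : M∖v.SumsTo ⟦ v ⟧ (λ _ → false)
    row-v-zero c _ = trans (M∖v.sumAt-⟦⟧ v c)
                           (trans (cong (λ b → E v c ∧ not b) (⟦⟧-refl v)) (∧-zeroʳ (E v c)))

  rk-decreases : M∖v.rk ≤ M.rk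
  rk-decreases with M∖v.rk-attained
  ... | p , indep , ∣p∣≡rk =
    subst (_≤ M.rk) ∣p∣≡rk (M.rk-upper (independent-avoiding⁻ (independent-avoids-v indep) indep))

  -- If the rank is kept, adding v to a basis of M∖v gives a dependency of M,
  -- which must contain v.
  rk-kept⇒in-dependency : M.rk ≡ M∖v.rk → Σ (Subset n) λ S → S v ≡ true × M.Dependency S
  rk-kept⇒in-dependency rk≡ with M∖v.rk-attained
  ... | p , indep , ∣p∣≡rk with independent-avoids-v indep
  ... | pv with independent₂ M.width (M.rowsOf (p ∪ ⟦ v ⟧)) in indep+v
  ... | true  = ⊥-elim (ℕ.<-irrefl refl (begin-strict
        ∣ p ∣               <⟨ ℕ.≤-reflexive (sym (∣∣-insert p v pv)) ⟩
        ∣ p ∪ ⟦ v ⟧ ∣       ≤⟨ M.rk-upper indep+v ⟩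
        M.rk                ≡⟨ trans rk≡ (sym ∣p∣≡rk) ⟩
        ∣ p ∣               ∎))
    where open ℕ.≤-Reasoning
  ... | false with M.dependent⇒dependency indep+v
  ... | q , q⊆p+v , q-dep with q v in qv
  ... | true  = q , qv , q-dep
  ... | false = ⊥-elim (M∖v.independent⇒no-dependency indep q⊆p
                  (proj₁ q-dep , λ c c∈ → trans (sumAt-avoiding {q} qv c) (proj₂ q-dep c c∈)))
    where
    q⊆p : q ⊆ p
    q⊆p w qw with p w in pw | q⊆p+v w qw
    ... | true  | _   = refl
    ... | false | w≡v with () ← trans (sym qv) (subst (λ y → q y ≡ true) (⟦⟧-sound w≡v) qw)

  -- If v lies in a dependency, a basis of M containing v can trade v for a
  -- row outside it, giving an equally large independent family of M∖v.
  in-dependency⇒rk-kept : {S : Subset n} → S v ≡ true → M.Dependency S → M.rk ≡ M∖v.rk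
  in-dependency⇒rk-kept {S} Sv S-dep = ℕ.≤-antisym rk≤ rk-decreases
    where
    rk≤ : M.rk ≤ M∖v.rk
    rk≤ with M.rk-attained
    ... | t , indep , ∣t∣≡rk with t v in tv
    ... | false = subst (_≤ M∖v.rk) ∣t∣≡rk (M∖v.rk-upper (independent-avoiding⁺ {t} tv indep))
    ... | true with M.exchange {t} {S} {v} indep tv S-dep Sv
    ... | u , tu , indep′ = subst (_≤ M∖v.rk) (trans (∣∣-swap {t = t} tv tu) ∣t∣≡rk)
                              (M∖v.rk-upper {t′} (independent-avoiding⁺ {t′} t′v indep′))
      where
      t′ : Subset n
      t′ = (t ∖ ⟦ v ⟧) ∪ ⟦ u ⟧
      u≢v : u ≢ v
      u≢v u≡v = case trans (sym tu) (subst (λ y → t y ≡ true) (sym u≡v) tv) of λ ()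
      t′v : t′ v ≡ false
      t′v rewrite tv | ⟦⟧-refl v = ⟦⟧-other u≢v

module Constraints (𝔄 : Structure τX) where
  open Semantics 𝔄 using (n; Tuple; tuples)

  Triple : Set
  Triple = Tuple (elem ∷ elem ∷ elem ∷ [])

  triples : List Triple
  triples = tuples (elem ∷ elem ∷ elem ∷ [])

  ∈-triples : (a b c : Fin n) → (a ∷ b ∷ c ∷ []) ∈ triples
  ∈-triples a b c = ∈-tuples (a ∷ b ∷ c ∷ [])
    where
    ∈-tuples : {ss : List Sort} (t : Tuple ss) → t ∈ tuples ss
    ∈-tuples {[]}       []      = here refl
    ∈-tuples {elem ∷ ss} (a ∷ t) = ∈-concat⁺′ (∈-map⁺ (a ∷_) (∈-tuples t)) (∈-map⁺ _ (∈-allFin a))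
    ∈-tuples {num ∷ ss}  (a ∷ t) = ∈-concat⁺′ (∈-map⁺ (a ∷_) (∈-tuples t)) (∈-map⁺ _ (∈-allFin a))

  R : Fin n → Fin n → Fin n → Bool
  R a b c = rel 𝔄 F.zero (a Vec.∷ b Vec.∷ c Vec.∷ Vec.[])

  live : Subset n → Fin n → Fin n → Fin n → Bool
  live D a b c = R a b c ∧ (not (D a) ∧ (not (D b) ∧ not (D c)))

  Live : Subset n → Fin n → Fin n → Fin n → Set
  Live D a b c = R a b c ≡ true × D a ≡ false × D b ≡ false × D c ≡ false

  live⁻ : {D : Subset n} {a b c : Fin n} → live D a b c ≡ true → Live D a b c
  live⁻ {D} {a} {b} {c} h with R a b c | D a | D b | D c
  ... | true | false | false | false = refl , refl , refl , refl

  live⁺ : {D : Subset n} {a b c : Fin n} → Live D a b c → live D a b c ≡ true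
  live⁺ (Ra , Da , Db , Dc) rewrite Ra | Da | Db | Dc = refl

  entry : Subset n → Fin n → Triple → Bool
  entry D u (a ∷ b ∷ c ∷ []) = live D a b c ∧ ((⟦ a ⟧ u xor ⟦ b ⟧ u) xor ⟦ c ⟧ u)

  module Matrix (D : Subset n) = RowSpace triples (entry D)

  sumAt-triple : (D q : Subset n) (a b c : Fin n) →
    Matrix.sumAt D q (a ∷ b ∷ c ∷ []) ≡ live D a b c ∧ ((q a xor q b) xor q c)
  sumAt-triple D q a b c with live D a b c
  ... | false = ⊕-sum-zero (λ u → q u ∧ false) {allFin n} (All.tabulate λ {u} _ → ∧-zeroʳ (q u))
  ... | true  = begin
    ⊕-sum (λ u → q u ∧ ((⟦ a ⟧ u xor ⟦ b ⟧ u) xor ⟦ c ⟧ u)) us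
      ≡⟨ ⊕-sum-cong us distribute ⟩
    ⊕-sum (λ u → ((⟦ a ⟧ u ∧ q u) xor (⟦ b ⟧ u ∧ q u)) xor (⟦ c ⟧ u ∧ q u)) us
      ≡⟨ ⊕-sum-xor (λ u → (⟦ a ⟧ u ∧ q u) xor (⟦ b ⟧ u ∧ q u)) (λ u → ⟦ c ⟧ u ∧ q u) us ⟩
    ⊕-sum (λ u → (⟦ a ⟧ u ∧ q u) xor (⟦ b ⟧ u ∧ q u)) us xor ⊕-sum (λ u → ⟦ c ⟧ u ∧ q u) us
      ≡⟨ cong₂ _xor_ (⊕-sum-xor (λ u → ⟦ a ⟧ u ∧ q u) (λ u → ⟦ b ⟧ u ∧ q u) us) (point c) ⟩
    (⊕-sum (λ u → ⟦ a ⟧ u ∧ q u) us xor ⊕-sum (λ u → ⟦ b ⟧ u ∧ q u) us) xor q c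
      ≡⟨ cong (_xor q c) (cong₂ _xor_ (point a) (point b)) ⟩
    (q a xor q b) xor q c ∎
    where
    open ≡-Reasoning
    us = allFin n
    point : (x : Fin n) → ⊕-sum (λ u → ⟦ x ⟧ u ∧ q u) us ≡ q x
    point x = ⊕-sum-point x q (allFin⁺ n) (∈-allFin x)
    distribute : ∀ u → q u ∧ ((⟦ a ⟧ u xor ⟦ b ⟧ u) xor ⟦ c ⟧ u) ≡
                       ((⟦ a ⟧ u ∧ q u) xor (⟦ b ⟧ u ∧ q u)) xor (⟦ c ⟧ u ∧ q u)
    distribute u = trans (∧-comm (q u) _)
      (trans (∧-distribʳ-xor (q u) (⟦ a ⟧ u xor ⟦ b ⟧ u) (⟦ c ⟧ u))
             (cong (_xor (⟦ c ⟧ u ∧ q u)) (∧-distribʳ-xor (q u) (⟦ a ⟧ u) (⟦ b ⟧ u))))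

  Even : Subset n → Subset n → Set
  Even D S = ∀ a b c → live D a b c ≡ true → (S a xor S b) xor S c ≡ false

  dependency⇒even : {D S : Subset n} → Matrix.Dependency D S → Even D S
  dependency⇒even {D} {S} (_ , S→0) a b c live-abc =
    subst (λ l → l ∧ ((S a xor S b) xor S c) ≡ false) live-abc
      (trans (sym (sumAt-triple D S a b c)) (S→0 (a ∷ b ∷ c ∷ []) (∈-triples a b c)))

  even⇒dependency : {D S : Subset n} → Nonempty S → Even D S → Matrix.Dependency D S
  even⇒dependency {D} {S} S≠∅ even =
    S≠∅ , λ { (a ∷ b ∷ c ∷ []) _ → trans (sumAt-triple D S a b c) (at a b c) }
    where
    at : ∀ a b c → live D a b c ∧ ((S a xor S b) xor S c) ≡ false
    at a b c with live D a b c in live-abc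
    ... | false = refl
    ... | true  = even a b c live-abc

  rank-kept : Subset n → Fin n → Bool
  rank-kept D v = Matrix.rk D ≡ᵇ RowSpace.rk triples (DeleteRow.E∖v triples (entry D) v)

  InEvenSet : Subset n → Fin n → Set
  InEvenSet D v = Σ (Subset n) λ S → S v ≡ true × Even D S

  rank-kept⇒in-even-set : {D : Subset n} {v : Fin n} → rank-kept D v ≡ true → InEvenSet D v
  rank-kept⇒in-even-set {D} {v} kept with DeleteRow.rk-kept⇒in-dependency triples (entry D) v (≡ᵇ⇒≡ kept)
  ... | S , Sv , S-dep = S , Sv , dependency⇒even S-dep

  in-even-set⇒rank-kept : {D : Subset n} {v : Fin n} → InEvenSet D v → rank-kept D v ≡ true
  in-even-set⇒rank-kept {D} {v} (S , Sv , even) = ≡⇒≡ᵇ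
    (DeleteRow.in-dependency⇒rk-kept triples (entry D) v {S} Sv (even⇒dependency {D} {S} (v , Sv) even))

  rank-kept-cong : {D D′ : Subset n} → (∀ u → D u ≡ D′ u) → (v : Fin n) →
    rank-kept D v ≡ rank-kept D′ v
  rank-kept-cong {D} {D′} D≗D′ v = cong₂ _≡ᵇ_ (rk-cong (λ u c → entry-cong u c))
    (rk-cong λ u c → cong (_∧ not (⟦ v ⟧ u)) (entry-cong u c))
    where
    entry-cong : ∀ u c → entry D u c ≡ entry D′ u c
    entry-cong u (a ∷ b ∷ c ∷ []) rewrite D≗D′ a | D≗D′ b | D≗D′ c = refl
    rk-cong : {E E′ : Fin n → Triple → Bool} → (∀ u c → E u c ≡ E′ u c) →
      RowSpace.rk triples E ≡ RowSpace.rk triples E′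
    rk-cong E≗E′ = cong (rank₂ _) (map-cong (λ u → map-cong (E≗E′ u) triples) (allFin n))

  stage : ℕ → Subset n
  stage zero    _ = false
  stage (suc k) u = stage k u ∨ rank-kept (stage k) u

  stage-⊆ : (k : ℕ) → stage k ⊆ stage (suc k)
  stage-⊆ k u discarded = cong (_∨ rank-kept (stage k) u) discarded

-- The sentence.  A stage of the fixed point is a unary relation D, read as the
-- set of discarded elements, and the body holds at v iff
--   ∃ν. rk(M_D) = ν ∧ rk(M_D with row v zeroed) = ν.

xorφ : ∀ {Δ Γ} → Formula τX Δ Γ → Formula τX Δ Γ → Formula τX Δ Γ
xorφ a b = neg (conj (neg (conj a (neg b))) (neg (conj (neg a) b)))

xorφ-meaning : ∀ a b → not (not (a ∧ not b) ∧ not (not a ∧ b)) ≡ a xor b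
xorφ-meaning true  true  = refl
xorφ-meaning true  false = refl
xorφ-meaning false true  = refl
xorφ-meaning false false = refl

Sorts³ : List Sort
Sorts³ = elem ∷ elem ∷ elem ∷ []

-- the free variables of a matrix entry: the row u, the column (a,b,c), the
-- number ν, the candidate v and the outer variable x
EntryContext : List Sort
EntryContext = elem ∷ Sorts³ ++ num ∷ elem ∷ elem ∷ []

StageVar : List (List Sort)
StageVar = (elem ∷ []) ∷ []

module EntryVariables where
  u a b c v : elem ∈ EntryContext
  u = here refl
  a = there (here refl)
  b = there (there (here refl))
  c = there (there (there (here refl)))
  v = there (there (there (there (there (here refl)))))

  outside : elem ∈ EntryContext → Formula τX StageVar EntryContext
  outside y = neg (rvar (here refl) (y ∷ []))

  entryφ : Formula τX StageVar EntryContext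
  entryφ = conj (conj (atom F.zero (a Vec.∷ b Vec.∷ c Vec.∷ Vec.[]))
                      (conj (outside a) (conj (outside b) (outside c))))
                (xorφ (xorφ (eq u a) (eq u b)) (eq u c))

  entry∖vφ : Formula τX StageVar EntryContext
  entry∖vφ = conj entryφ (neg (eq u v))

open EntryVariables using (entryφ; entry∖vφ)

bodyφ : Formula τX StageVar (elem ∷ elem ∷ [])
bodyφ = exi num (conj (rank (elem ∷ []) Sorts³ entryφ   1 (here refl Vec.∷ Vec.[]))
                      (rank (elem ∷ []) Sorts³ entry∖vφ 1 (here refl Vec.∷ Vec.[])))

-- some element is never discarded
sentence : Sentence τX
sentence = exi elem (neg (ifp (elem ∷ []) bodyφ (here refl ∷ [])))

number-witness : {n a : ℕ} (b : ℕ) → a ≤ n →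
  any (λ (ν : Fin (suc n)) → (a ≡ᵇ toℕ ν) ∧ (b ≡ᵇ toℕ ν)) (allFin (suc n)) ≡ (a ≡ᵇ b)
number-witness {n} {a} b a≤n = true-ext agree⇒equal equal⇒agree
  where
  both-equal : Fin (suc n) → Bool
  both-equal ν = (a ≡ᵇ toℕ ν) ∧ (b ≡ᵇ toℕ ν)
  agree⇒equal : any both-equal (allFin (suc n)) ≡ true → (a ≡ᵇ b) ≡ true
  agree⇒equal h with any-elim both-equal {allFin (suc n)} h
  ... | ν , _ , both = ≡⇒≡ᵇ (trans (≡ᵇ⇒≡ {a} (∧-conicalˡ (a ≡ᵇ toℕ ν) _ both))
                                  (sym (≡ᵇ⇒≡ {b} (∧-conicalʳ _ (b ≡ᵇ toℕ ν) both))))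
  ν : Fin (suc n)
  ν = fromℕ< (s≤s a≤n)
  ν≡a : toℕ ν ≡ a
  ν≡a = toℕ-fromℕ< (s≤s a≤n)
  equal⇒agree : (a ≡ᵇ b) ≡ true → any both-equal (allFin (suc n)) ≡ true
  equal⇒agree a≡ᵇb = any-intro both-equal (∈-allFin ν)
    (cong₂ _∧_ (≡⇒≡ᵇ (sym ν≡a)) (≡⇒≡ᵇ (trans (sym (≡ᵇ⇒≡ {a} a≡ᵇb)) (sym ν≡a))))

module Meaning (𝔄 : Structure τX) where
  open Semantics 𝔄 using (n; Tuple; tuples; _⊕_; eval; iterate)
  open Constraints 𝔄

  asSubset : (Tuple (elem ∷ []) → Bool) → Subset n
  asSubset Dᵣ w = Dᵣ (w ∷ [])

  entryφ-meaning : (Dᵣ : Tuple (elem ∷ []) → Bool) (ρ : Tuple (num ∷ elem ∷ elem ∷ [])) (u : Fin n) (col : Triple) →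
    eval entryφ (Dᵣ ∷ []) ((u ∷ []) ⊕ (col ⊕ ρ)) ≡ entry (asSubset Dᵣ) u col
  entryφ-meaning Dᵣ ρ u (a ∷ b ∷ c ∷ []) = cong (live (asSubset Dᵣ) a b c ∧_)
    (trans (xorφ-meaning a⊕b (⟦ c ⟧ u)) (cong (_xor ⟦ c ⟧ u) (xorφ-meaning (⟦ a ⟧ u) (⟦ b ⟧ u))))
    where
    a⊕b : Bool
    a⊕b = not (not (⟦ a ⟧ u ∧ not (⟦ b ⟧ u)) ∧ not (not (⟦ a ⟧ u) ∧ ⟦ b ⟧ u))

  entry∖vφ-meaning : (Dᵣ : Tuple (elem ∷ []) → Bool) (ν : Fin (suc n)) (v : Fin n) (ρ : Tuple (elem ∷ []))
    (u : Fin n) (col : Triple) →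
    eval entry∖vφ (Dᵣ ∷ []) ((u ∷ []) ⊕ (col ⊕ (ν ∷ v ∷ ρ))) ≡ DeleteRow.E∖v triples (entry (asSubset Dᵣ)) v u col
  entry∖vφ-meaning Dᵣ ν v ρ u col@(_ ∷ _ ∷ _ ∷ []) =
    cong (_∧ not (⟦ v ⟧ u)) (entryφ-meaning Dᵣ (ν ∷ v ∷ ρ) u col)

  tuples-single : tuples (elem ∷ []) ≡ map (_∷ []) (allFin n)
  tuples-single = trans (sym (concatMap-map [_] (_∷ []) (allFin n))) (concatMap-pure (map (_∷ []) (allFin n)))

  rank-meaning : (φ : Formula τX StageVar EntryContext) (Dᵣ : Tuple (elem ∷ []) → Bool)
    (E : Fin n → Triple → Bool) (ν : Fin (suc n)) (ρ : Tuple (elem ∷ elem ∷ [])) →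
    (∀ u col → eval φ (Dᵣ ∷ []) ((u ∷ []) ⊕ (col ⊕ (ν ∷ ρ))) ≡ E u col) →
    eval (rank (elem ∷ []) Sorts³ φ 1 (here refl Vec.∷ Vec.[])) (Dᵣ ∷ []) (ν ∷ ρ)
      ≡ (RowSpace.rk triples E ≡ᵇ toℕ ν)
  rank-meaning φ Dᵣ E ν ρ φ≡E = cong₂ _≡ᵇ_ (cong (rank₂ (length triples)) matrix≡) numVal≡
    where
    matrix≡ : map (λ x → map (λ y → eval φ (Dᵣ ∷ []) (x ⊕ (y ⊕ (ν ∷ ρ)))) triples) (tuples (elem ∷ []))
              ≡ map (RowSpace.row triples E) (allFin n)
    matrix≡ = trans (cong (map _) tuples-single)
                (trans (sym (map-∘ (allFin n))) (map-cong (λ u → map-cong (φ≡E u) triples) (allFin n)))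
    numVal≡ : toℕ ν + suc n * 0 ≡ toℕ ν
    numVal≡ rewrite ℕ.*-zeroʳ (suc n) = ℕ.+-identityʳ (toℕ ν)

  body-meaning : (Dᵣ : Tuple (elem ∷ []) → Bool) (v : Fin n) (ρ : Tuple (elem ∷ [])) →
    eval bodyφ (Dᵣ ∷ []) (v ∷ ρ) ≡ rank-kept (asSubset Dᵣ) v
  body-meaning Dᵣ v ρ = trans (cong or (map-cong ranks (allFin (suc n))))
                              (number-witness _ (RowSpace.rk≤n triples (entry D)))
    where
    D = asSubset Dᵣ
    ranks : ∀ ν → eval (conj (rank (elem ∷ []) Sorts³ entryφ   1 (here refl Vec.∷ Vec.[]))
                              (rank (elem ∷ []) Sorts³ entry∖vφ 1 (here refl Vec.∷ Vec.[]))) (Dᵣ ∷ []) (ν ∷ v ∷ ρ)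
                ≡ (Matrix.rk D ≡ᵇ toℕ ν) ∧ (RowSpace.rk triples (DeleteRow.E∖v triples (entry D) v) ≡ᵇ toℕ ν)
    ranks ν = cong₂ _∧_ (rank-meaning entryφ Dᵣ (entry D) ν (v ∷ ρ) (entryφ-meaning Dᵣ (ν ∷ v ∷ ρ)))
                        (rank-meaning entry∖vφ Dᵣ _ ν (v ∷ ρ) (entry∖vφ-meaning Dᵣ ν v ρ))

  ifp-stage : Tuple (elem ∷ []) → ℕ → Tuple (elem ∷ []) → Bool
  ifp-stage ρ k = iterate k (λ Dᵣ t → Dᵣ t ∨ eval bodyφ (Dᵣ ∷ []) (t ⊕ ρ)) (λ _ → false)

  ifp-stage≡stage : (ρ : Tuple (elem ∷ [])) (k : ℕ) (u : Fin n) → ifp-stage ρ k (u ∷ []) ≡ stage k u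
  ifp-stage≡stage ρ zero    u = refl
  ifp-stage≡stage ρ (suc k) u = cong₂ _∨_ (ifp-stage≡stage ρ k u)
    (trans (body-meaning (ifp-stage ρ k) u ρ) (rank-kept-cong (ifp-stage≡stage ρ k) u))

  sentence-meaning : eval sentence [] [] ≡ any (λ a → not (stage n a)) (allFin n)
  sentence-meaning = cong or (map-cong (λ a → cong not (survives a)) (allFin n))
    where
    length≡n : length (tuples (elem ∷ [])) ≡ n
    length≡n = trans (cong length tuples-single) (trans (length-map _ (allFin n)) (length-tabulate (λ u → u)))
    survives : ∀ a → ifp-stage (a ∷ []) (length (tuples (elem ∷ []))) (a ∷ []) ≡ stage n a
    survives a = trans (ifp-stage≡stage (a ∷ []) (length (tuples (elem ∷ []))) a)
                       (cong (λ k → stage k a) length≡n)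

even-triple : {x y z : Bool} → (x ≡ y × z ≡ false) ⊎ (y ≡ z × x ≡ false) ⊎ (z ≡ x × y ≡ false) →
  (x xor y) xor z ≡ false
even-triple {x}     (inj₁ (refl , refl))        = trans (xor-identityʳ _) (xor-same x)
even-triple {y = y} (inj₂ (inj₁ (refl , refl))) = xor-same y
even-triple {x}     (inj₂ (inj₂ (refl , refl))) = trans (cong (_xor x) (xor-identityʳ x)) (xor-same x)

least-outside : {n : ℕ} (value : Fin n → ℚ) (D : Subset n) {u₀ : Fin n} → D u₀ ≡ false →
  Σ (Fin n) λ v → D v ≡ false × (∀ w → D w ≡ false → value v ℚ.≤ value w)
least-outside {n} value D Du₀ = let v , Dv , _ , v-least = least-in (allFin n) Du₀ in
  v , Dv , λ w → v-least (∈-allFin w)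
  where
  least-in : (xs : List (Fin n)) {cur : Fin n} → D cur ≡ false →
    Σ (Fin n) λ v → D v ≡ false × value v ℚ.≤ value cur × (∀ {w} → w ∈ xs → D w ≡ false → value v ℚ.≤ value w)
  least-in []       {cur} Dcur = cur , Dcur , ℚₚ.≤-refl , λ ()
  least-in (x ∷ xs) {cur} Dcur with D x in Dx | value cur ℚ.≤? value x
  ... | true  | _ = let v , Dv , v≤cur , v-least = least-in xs Dcur in
    v , Dv , v≤cur , λ { (here refl) Dw → case trans (sym Dw) Dx of λ () ; (there w∈) Dw → v-least w∈ Dw }
  ... | false | yes cur≤x = let v , Dv , v≤cur , v-least = least-in xs Dcur in
    v , Dv , v≤cur , λ { (here refl) _ → ℚₚ.≤-trans v≤cur cur≤x ; (there w∈) Dw → v-least w∈ Dw }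
  ... | false | no  cur≰x = let v , Dv , v≤x , v-least = least-in xs Dx in
    v , Dv , ℚₚ.≤-trans v≤x (ℚₚ.<⇒≤ (ℚₚ.≰⇒> cur≰x)) ,
    λ { (here refl) _ → v≤x ; (there w∈) Dw → v-least w∈ Dw }

-- Soundness: under a homomorphism h to (ℚ; X), the live elements of least
-- h-value form an even set, so each stage discards a new element until
-- all are discarded.

module Soundness (𝔄 : Structure τX) (hom : HomToQX 𝔄) where
  open Semantics 𝔄 using (n)
  open Constraints 𝔄

  value : Fin n → ℚ
  value = proj₁ hom

  respects : ∀ a b c → R a b c ≡ true → X (value a) (value b) (value c)
  respects a b c = proj₂ hom (a Vec.∷ b Vec.∷ c Vec.∷ Vec.[])

  level : Subset n → Fin n → Subset n
  level D v w = not (D w) ∧ does (value w ℚ.≟ value v)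

  -- If v has least value, its level is an even set: a live constraint has
  -- two entries of equal value below the third, so it meets the level in 0
  -- or 2 elements.
  level-even : {D : Subset n} {v : Fin n} → (∀ w → D w ≡ false → value v ℚ.≤ value w) → Even D (level D v)
  level-even {D} {v} v-least a b c live-abc with live⁻ live-abc
  ... | Rabc , Da , Db , Dc = even-triple (shape (respects a b c Rabc))
    where
    at : ∀ {w} → D w ≡ false → level D v w ≡ does (value w ℚ.≟ value v)
    at Dw rewrite Dw = refl
    same : ∀ {w w′} → D w ≡ false → D w′ ≡ false → value w ≡ value w′ → level D v w ≡ level D v w′
    same Dw Dw′ e = trans (at Dw) (trans (cong (λ q → does (q ℚ.≟ value v)) e) (sym (at Dw′)))
    above : ∀ {w z} → D w ≡ false → D z ≡ false → value w ℚ.< value z → level D v z ≡ false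
    above {w} {z} Dw Dz w<z with value z ℚ.≟ value v | at Dz
    ... | no  _   | e = e
    ... | yes z≡v | _ = ⊥-elim (ℚₚ.<-irrefl (sym z≡v) (ℚₚ.≤-<-trans (v-least w Dw) w<z))
    shape : X (value a) (value b) (value c) →
      (level D v a ≡ level D v b × level D v c ≡ false) ⊎ (level D v b ≡ level D v c × level D v a ≡ false) ⊎
      (level D v c ≡ level D v a × level D v b ≡ false)
    shape (inj₁ (a≡b , b<c))        = inj₁ (same Da Db a≡b , above Db Dc b<c)
    shape (inj₂ (inj₁ (b≡c , c<a))) = inj₂ (inj₁ (same Db Dc b≡c , above Dc Da c<a))
    shape (inj₂ (inj₂ (c≡a , a<b))) = inj₂ (inj₂ (same Dc Da c≡a , above Da Db a<b))

  stage-grows : ∀ k → (∀ u → stage k u ≡ true) ⊎ k ≤ ∣ stage k ∣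
  stage-grows zero = inj₂ z≤n
  stage-grows (suc k) with stage-grows k | nonempty? (λ u → not (stage k u))
  ... | inj₁ everything | _ = inj₁ λ u → stage-⊆ k u (everything u)
  ... | inj₂ _ | inj₂ none = inj₁ λ u → stage-⊆ k u (not-injective (none u))
  ... | inj₂ k≤∣stage∣ | inj₁ (u₀ , u₀-live) with least-outside value (stage k) (not-injective u₀-live)
  ... | v , v-live , v-least = inj₂ (ℕ.≤-trans (s≤s k≤∣stage∣) (∣∣-strict v (stage-⊆ k) v-live v-discarded))
    where
    v-discarded : stage (suc k) v ≡ true
    v-discarded rewrite v-live = in-even-set⇒rank-kept (level (stage k) v , level-v , level-even v-least)
      where
      level-v : level (stage k) v v ≡ true
      level-v rewrite v-live with value v ℚ.≟ value v
      ... | yes _   = refl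
      ... | no  v≢v = ⊥-elim (v≢v refl)

  all-discarded : ∀ u → stage n u ≡ true
  all-discarded with stage-grows n
  ... | inj₁ everything = everything
  ... | inj₂ n≤∣stage∣  = ∣∣-full (stage n) n≤∣stage∣

-- Completeness: the stages are peeled off from the last to the first.  Each
-- new element of a stage lies in an even set S of the previous stage; S is
-- placed at value 0 below a shifted solution of the remaining constraints.

Xℕ : ℕ → ℕ → ℕ → Set
Xℕ x y z = (x ≡ y × y < z) ⊎ (y ≡ z × z < x) ⊎ (z ≡ x × x < y)

lower-even : ∀ sa sb sc {x y z} → (sa xor sb) xor sc ≡ false →
  (sa ≡ false → sb ≡ false → sc ≡ false → Xℕ x y z) →
  Xℕ (if sa then 0 else suc x) (if sb then 0 else suc y) (if sc then 0 else suc z)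
lower-even true  true  false _ _ = inj₁ (refl , s≤s z≤n)
lower-even false true  true  _ _ = inj₂ (inj₁ (refl , s≤s z≤n))
lower-even true  false true  _ _ = inj₂ (inj₂ (refl , s≤s z≤n))
lower-even false false false _ rest with rest refl refl refl
... | inj₁ (x≡y , y<z)        = inj₁ (cong suc x≡y , s≤s y<z)
... | inj₂ (inj₁ (y≡z , z<x)) = inj₂ (inj₁ (cong suc y≡z , s≤s z<x))
... | inj₂ (inj₂ (z≡x , x<y)) = inj₂ (inj₂ (cong suc z≡x , s≤s x<y))
lower-even true  true  true  () _
lower-even true  false false () _
lower-even false true  false () _
lower-even false false true  () _

-- The embedding of ℕ into ℚ is strictly monotone, so it preserves X.
toℚ : ℕ → ℚ
toℚ zero    = ℚ.0ℚ
toℚ (suc k) = toℚ k ℚ.+ ℚ.1ℚ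

toℚ-suc : ∀ k → toℚ k ℚ.< toℚ (suc k)
toℚ-suc k = subst (ℚ._< toℚ (suc k)) (ℚₚ.+-identityʳ (toℚ k)) (ℚₚ.+-monoʳ-< (toℚ k) (ℚₚ.positive⁻¹ ℚ.1ℚ))

toℚ-< : {a b : ℕ} → a < b → toℚ a ℚ.< toℚ b
toℚ-< {a} {suc b} (s≤s a≤b) with ℕ.m≤n⇒m<n∨m≡n a≤b
... | inj₁ a<b  = ℚₚ.<-trans (toℚ-< a<b) (toℚ-suc b)
... | inj₂ refl = toℚ-suc a

toℚ-X : {x y z : ℕ} → Xℕ x y z → X (toℚ x) (toℚ y) (toℚ z)
toℚ-X (inj₁ (x≡y , y<z))        = inj₁ (cong toℚ x≡y , toℚ-< y<z)
toℚ-X (inj₂ (inj₁ (y≡z , z<x))) = inj₂ (inj₁ (cong toℚ y≡z , toℚ-< z<x))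
toℚ-X (inj₂ (inj₂ (z≡x , x<y))) = inj₂ (inj₂ (cong toℚ z≡x , toℚ-< x<y))

module Completeness (𝔄 : Structure τX) where
  open Semantics 𝔄 using (n)
  open Constraints 𝔄

  Solution : Subset n → Set
  Solution D = Σ (Fin n → ℕ) λ g → ∀ a b c → live D a b c ≡ true → Xℕ (g a) (g b) (g c)

  live-anti : {D D′ : Subset n} → D ⊆ D′ → ∀ {a b c} → live D′ a b c ≡ true → live D a b c ≡ true
  live-anti {D} {D′} D⊆D′ {a} {b} {c} live′ with live⁻ {D′} {a} {b} {c} live′
  ... | Rabc , D′a , D′b , D′c = live⁺ {D} (Rabc , outside D′a , outside D′b , outside D′c)
    where
    outside : ∀ {w} → D′ w ≡ false → D w ≡ false
    outside {w} D′w with D w in Dw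
    ... | false = refl
    ... | true  = case trans (sym (D⊆D′ w Dw)) D′w of λ ()

  solution-mono : {D D′ : Subset n} → D ⊆ D′ → Solution D → Solution D′
  solution-mono D⊆D′ (g , g-sol) = g , λ a b c live′ → g-sol a b c (live-anti D⊆D′ live′)

  even-mono : {D D′ S : Subset n} → D ⊆ D′ → Even D S → Even D′ S
  even-mono D⊆D′ even a b c live′ = even a b c (live-anti D⊆D′ live′)

  peel : {D S : Subset n} → Even D S → Solution (D ∪ S) → Solution D
  peel {D} {S} even (g , g-sol) = (λ u → if S u then 0 else suc (g u)) , sol
    where
    sol : ∀ a b c → live D a b c ≡ true →
      Xℕ (if S a then 0 else suc (g a)) (if S b then 0 else suc (g b)) (if S c then 0 else suc (g c))
    sol a b c live-abc with live⁻ {D} {a} {b} {c} live-abc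
    ... | Rabc , Da , Db , Dc = lower-even (S a) (S b) (S c) (even a b c live-abc) λ Sa Sb Sc →
      g-sol a b c (live⁺ {D ∪ S} (Rabc , cong₂ _∨_ Da Sa , cong₂ _∨_ Db Sb , cong₂ _∨_ Dc Sc))

  peel-all : (m : ℕ) {D D′ : Subset n} → ∣ D′ ∖ D ∣ ≤ m →
    (∀ w → (D′ ∖ D) w ≡ true → InEvenSet D w) → Solution D′ → Solution D
  peel-all m {D} {D′} size layers sol with nonempty? (D′ ∖ D)
  ... | inj₂ none = solution-mono D′⊆D sol
    where
    D′⊆D : D′ ⊆ D
    D′⊆D w D′w with D w in Dw | none w
    ... | true  | _  = refl
    ... | false | D′∖D-w rewrite D′w = case D′∖D-w of λ ()
  ... | inj₁ (w , w-new) with layers w w-new | m | size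
  ... | _ | zero   | size≤0 = case ℕ.≤-trans (∣∣-strict w (λ _ ()) refl w-new) size≤0 of λ ()
  ... | S , Sw , even | suc m′ | size≤m = peel {D} {S} even (peel-all m′ {D₁} {D′} smaller layers′ sol)
    where
    D₁ = D ∪ S
    shrinks : (D′ ∖ D₁) ⊆ (D′ ∖ D)
    shrinks u h rewrite ∨-conicalˡ (D u) (S u) (not-injective (∧-conicalʳ (D′ u) _ h)) =
      trans (∧-identityʳ (D′ u)) (∧-conicalˡ (D′ u) _ h)
    smaller : ∣ D′ ∖ D₁ ∣ ≤ m′
    smaller = ℕ.≤-pred (ℕ.≤-trans (∣∣-strict w shrinks w-old w-new) size≤m)
      where
      w-old : (D′ ∖ D₁) w ≡ false
      w-old rewrite Sw | ∨-zeroʳ (D w) = ∧-zeroʳ (D′ w)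
    layers′ : ∀ u → (D′ ∖ D₁) u ≡ true → InEvenSet D₁ u
    layers′ u h = let S′ , S′u , even′ = layers u (shrinks u h) in
      S′ , S′u , even-mono {D} {D₁} {S′} (λ v Dv → cong (_∨ S v) Dv) even′

  -- with every element discarded no constraint is live
  solution-everything : {D : Subset n} → (∀ u → D u ≡ true) → Solution D
  solution-everything {D} everything = (λ _ → 0) , λ a b c live-abc →
    case trans (sym (everything a)) (proj₁ (proj₂ (live⁻ {D} {a} {b} {c} live-abc))) of λ ()

  stage-layers : (k : ℕ) (w : Fin n) → (stage (suc k) ∖ stage k) w ≡ true → InEvenSet (stage k) w
  stage-layers k w new with stage k w
  ... | false = rank-kept⇒in-even-set (trans (sym (∧-identityʳ _)) new)

  solution-from : (∀ u → stage n u ≡ true) → (j k : ℕ) → j + k ≡ n → Solution (stage k)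
  solution-from everything zero    k refl = solution-everything everything
  solution-from everything (suc j) k j+k≡n =
    peel-all n {stage k} {stage (suc k)} (∣∣≤n _) (stage-layers k)
      (solution-from everything j (suc k) (trans (ℕ.+-suc j k) j+k≡n))

  homomorphism : (∀ u → stage n u ≡ true) → HomToQX 𝔄
  homomorphism everything with solution-from everything n 0 (ℕ.+-identityʳ n)
  ... | g , g-sol = toℚ ∘ g , λ { (a Vec.∷ b Vec.∷ c Vec.∷ Vec.[]) Rabc →
                                   toℚ-X (g-sol a b c (live⁺ {stage 0} (Rabc , refl , refl , refl))) }

sentence-correct : (𝔄 : Structure τX) → (𝔄 ⊨ sentence) ⇔ (¬ HomToQX 𝔄)
sentence-correct 𝔄 = mk⇔ holds⇒no-hom no-hom⇒holds
  where
  open Semantics 𝔄 using (n)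
  open Constraints 𝔄 using (stage)
  holds⇒no-hom : 𝔄 ⊨ sentence → ¬ HomToQX 𝔄
  holds⇒no-hom holds hom with any-elim _ {allFin n} (trans (sym (Meaning.sentence-meaning 𝔄)) holds)
  ... | a , _ , kept = case trans (sym (cong not (Soundness.all-discarded 𝔄 hom a))) kept of λ ()
  no-hom⇒holds : ¬ HomToQX 𝔄 → 𝔄 ⊨ sentence
  no-hom⇒holds no-hom with nonempty? (λ a → not (stage n a))
  ... | inj₁ (a , kept) = trans (Meaning.sentence-meaning 𝔄) (any-intro _ (∈-allFin a) kept)
  ... | inj₂ none       = ⊥-elim (no-hom (Completeness.homomorphism 𝔄 (λ u → not-injective (none u))))

proposition4p6 : FPR₂-expressible-co HomToQX
proposition4p6 = sentence , sentence-correct
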